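{- For all lists of integers $c_1,c_2$: if $\mathit{Wf}\ c_1$, $\mathit{Wf}\ c_2$ and $\mathit{UniqueCompPair}\ c_1\ c_2$ hold, then for all integers $\ell_1,\ell_2$ with $\ell_1\in c_1$, $\ell_2\in c_2$ and $\ell_1+\ell_2=0$, we have $\ell_1\notin c_1\bowtie c_2$ and $\ell_2\notin c_1\bowtie c_2$.
   Context: Literals are integers and clauses are finite lists of integers. Lists are written $x::xs$ (cons) and $\mathit{nil}$ (empty); $\mathit{rev}$ reverses a list, $\mathit{app}$ concatenates two lists, $\mathit{abs}$ is the absolute value, and $\in$ denotes list membership. The function $\mathit{auxunion}(c_1,c_2,acc)$ is defined recursively by: - if $c_1=\mathit{nil}$, return $\mathit{app}(\mathit{rev}\ acc, c_2)$; - else if $c_2=\mathit{nil}$, return $\mathit{app}(\mathit{rev}\ acc, c_1)$; - else, with $c_1=x::xs$ and $c_2=y::ys$: - if $\mathit{abs}\,x<\mathit{abs}\,y$, return $\mathit{auxunion}(xs,y::ys,x::acc)$; - else if $\mathit{abs}\,y<\mathit{abs}\,x$, return $\mathit{auxunion}(x::xs,ys,y::acc)$; - else if $x=y$, return $\mathit{auxunion}(xs,ys,x::acc)$; - else return $\mathit{auxunion}(xs,ys,x::y::acc)$. The function $\mathit{union}(c_1,c_2,acc)$ is defined recursively by: - if $c_1=\mathit{nil}$, return $\mathit{app}(\mathit{rev}\ acc,c_2)$; - else if $c_2=\mathit{nil}$, return $\mathit{app}(\mathit{rev}\ acc,c_1)$; - else, with $c_1=x::xs$ and $c_2=y::ys$: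 - if $x+y=0$, return $\mathit{auxunion}(xs,ys,acc)$; - else if $\mathit{abs}\,x<\mathit{abs}\,y$, return $\mathit{union}(xs,y::ys,x::acc)$; - else if $\mathit{abs}\,y<\mathit{abs}\,x$, return $\mathit{union}(x::xs,ys,y::acc)$; - else return $\mathit{union}(xs,ys,x::acc)$. The resolution function is $c_1\bowtie c_2:=\mathit{union}(c_1,c_2,\mathit{nil})$. $\mathit{Wf}\ c$ means the conjunction of three conditions: - $\mathit{NoCompPair}\ c$: there is no literal $x\in c$ with $-x\in c$; - $\mathit{NoDup}\ c$: $c$ has no duplicate elements; - $\mathit{sorted}\ c$: $c$ is sorted in ascending order of absolute value. $\mathit{UniqueCompPair}\ c_1\ c_2$ means that there is exactly one pair $(\ell_1,\ell_2)$ with $\ell_1\in c_1$, $\ell_2\in c_2$ and $\ell_1+\ell_2=0$. -}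

module Defs where

open import Data.Integer using (ℤ; _+_; -_; ∣_∣; 0ℤ)
open import Data.Nat using (_<_; _≤_)
open import Data.Nat.Properties using (_<?_)
open import Data.Integer.Properties using (_≟_)
open import Data.List using (List; []; _∷_; reverse; _++_)
open import Data.List.Membership.Propositional using (_∈_)
open import Data.List.Relation.Unary.Unique.Propositional using (Unique)
open import Data.Product using (_×_; Σ; _,_)
open import Relation.Binary.PropositionalEquality using (_≡_)
open import Relation.Nullary using (¬_; yes; no)
open import Relation.Nullary.Decidable using (⌊_⌋)
open import Data.Bool using (if_then_else_)

Clause : Set
Clause = List ℤ

auxunion : Clause → Clause → Clause → Clause
auxunion [] c2 acc = reverse acc ++ c2
auxunion (x ∷ xs) [] acc = reverse acc ++ (x ∷ xs)
auxunion (x ∷ xs) (y ∷ ys) acc =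
  if ⌊ ∣ x ∣ <? ∣ y ∣ ⌋ then auxunion xs (y ∷ ys) (x ∷ acc)
  else if ⌊ ∣ y ∣ <? ∣ x ∣ ⌋ then auxunion (x ∷ xs) ys (y ∷ acc)
  else if ⌊ x ≟ y ⌋ then auxunion xs ys (x ∷ acc)
  else auxunion xs ys (x ∷ y ∷ acc)

union : Clause → Clause → Clause → Clause
union [] c2 acc = reverse acc ++ c2
union (x ∷ xs) [] acc = reverse acc ++ (x ∷ xs)
union (x ∷ xs) (y ∷ ys) acc =
  if ⌊ x + y ≟ 0ℤ ⌋ then auxunion xs ys acc
  else if ⌊ ∣ x ∣ <? ∣ y ∣ ⌋ then union xs (y ∷ ys) (x ∷ acc)
  else if ⌊ ∣ y ∣ <? ∣ x ∣ ⌋ then union (x ∷ xs) ys (y ∷ acc)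
  else union xs ys (x ∷ acc)

_⋈_ : Clause → Clause → Clause
c1 ⋈ c2 = union c1 c2 []

NoCompPair : Clause → Set
NoCompPair c = ∀ x → x ∈ c → ¬ (- x ∈ c)

NoDup : Clause → Set
NoDup c = Unique c

data SortedAbs : Clause → Set where
  sorted-[] : SortedAbs []
  sorted-[x] : ∀ x → SortedAbs (x ∷ [])
  sorted-∷ : ∀ {x y l} → ∣ x ∣ ≤ ∣ y ∣ → SortedAbs (y ∷ l) → SortedAbs (x ∷ y ∷ l)

Wf : Clause → Set
Wf c = NoCompPair c × NoDup c × SortedAbs c

UniqueCompPair : Clause → Clause → Set
UniqueCompPair c1 c2 =
  Σ ℤ λ l1 → Σ ℤ λ l2 → (l1 ∈ c1 × l2 ∈ c2 × l1 + l2 ≡ 0ℤ) ×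
    (∀ m1 m2 → m1 ∈ c1 → m2 ∈ c2 → m1 + m2 ≡ 0ℤ → (m1 ≡ l1 × m2 ≡ l2))

-- A well-formed clause is strictly sorted by absolute value, so l₁ and l₂ = - l₁ are
-- the only literals of absolute value ∣ l₁ ∣ in c₁ and c₂. While union walks both
-- clauses, every literal it emits before reaching them lies strictly below ∣ l₁ ∣;
-- uniqueness of the clash makes (l₁ , l₂) the first complementary pair of heads,
-- which is dropped, and everything auxunion emits afterwards lies strictly above.
module Submission where

open import Defs
open import Data.Integer using (ℤ; _+_; 0ℤ; -_; ∣_∣; +_; -[1+_])
open import Data.Integer.Properties
  using (_≟_; ∣-i∣≡∣i∣; +-0-abelianGroup; +-inverseʳ)
open import Data.Nat using (ℕ; _<_; _≤_)
open import Data.Nat.Properties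
  using ( _<?_; ≤-refl; ≤-trans; ≤-reflexive; ≤-antisym; <⇒≤; <⇒≢; <⇒≱; <-irrefl
        ; <-≤-trans; ≤∧≢⇒<; ≮⇒≥)
open import Data.List using (List; []; _∷_; reverse)
open import Data.List.Membership.Propositional using (_∈_; _∉_)
open import Data.List.Relation.Unary.All as All using (All; []; _∷_)
open import Data.List.Relation.Unary.All.Properties using (++⁺; ¬Any⇒All¬)
open import Data.List.Relation.Unary.AllPairs using (AllPairs; []; _∷_)
open import Data.List.Relation.Unary.Any as Any using (here; there)
open import Data.List.Relation.Binary.Permutation.Propositional using (↭-sym)
open import Data.List.Relation.Binary.Permutation.Propositional.Properties
  using (All-resp-↭; ↭-reverse)
open import Data.Product using (_×_; _,_; proj₁)
open import Relation.Nullary using (Dec; yes; no; ¬_; contradiction)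
open import Relation.Nullary.Decidable using (⌊_⌋)
open import Data.Bool using (if_then_else_)
open import Relation.Binary.PropositionalEquality
  using (_≡_; _≢_; ≢-sym; refl; sym; trans; cong; subst)
open import Algebra.Properties.AbelianGroup +-0-abelianGroup using (inverseʳ-unique)

i≢j∧-i≢j⇒∣i∣≢∣j∣ : ∀ {i j} → i ≢ j → - i ≢ j → ∣ i ∣ ≢ ∣ j ∣
i≢j∧-i≢j⇒∣i∣≢∣j∣ {+ _}       {+ _}       i≢j _    refl = i≢j refl
i≢j∧-i≢j⇒∣i∣≢∣j∣ {+ _}       { -[1+ _ ]} _   -i≢j refl = -i≢j refl
i≢j∧-i≢j⇒∣i∣≢∣j∣ { -[1+ _ ]} {+ _}       _   -i≢j refl = -i≢j refl
i≢j∧-i≢j⇒∣i∣≢∣j∣ { -[1+ _ ]} { -[1+ _ ]} i≢j _    refl = i≢j refl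

StrictlyAbsSorted : Clause → Set
StrictlyAbsSorted = AllPairs (λ a b → ∣ a ∣ < ∣ b ∣)

AbsAvoids : ℕ → Clause → Set
AbsAvoids n = All (λ z → ∣ z ∣ ≢ n)

sortedAbs⇒AllPairs : ∀ {c} → SortedAbs c → AllPairs (λ a b → ∣ a ∣ ≤ ∣ b ∣) c
sortedAbs⇒AllPairs sorted-[]       = []
sortedAbs⇒AllPairs (sorted-[x] _)  = [] ∷ []
sortedAbs⇒AllPairs (sorted-∷ le s) with sortedAbs⇒AllPairs s
... | y≤ ∷ rest = (le ∷ All.map (≤-trans le) y≤) ∷ y≤ ∷ rest

abs≤-sorted⇒strictlyAbsSorted : ∀ {c} → NoCompPair c → NoDup c →
  AllPairs (λ a b → ∣ a ∣ ≤ ∣ b ∣) c → StrictlyAbsSorted c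
abs≤-sorted⇒strictlyAbsSorted _ [] [] = []
abs≤-sorted⇒strictlyAbsSorted {x ∷ c} noComp (x∉ ∷ noDup) (x≤ ∷ sorted) =
  All.tabulate (λ z∈ → ≤∧≢⇒< (All.lookup x≤ z∈)
                             (i≢j∧-i≢j⇒∣i∣≢∣j∣ (All.lookup x∉ z∈) (All.lookup -x∉ z∈)))
  ∷ abs≤-sorted⇒strictlyAbsSorted (λ y y∈ -y∈ → noComp y (there y∈) (there -y∈)) noDup sorted
  where
  -x∉ : All (- x ≢_) c
  -x∉ = ¬Any⇒All¬ c (λ -x∈ → noComp x (here refl) (there -x∈))

wf⇒strictlyAbsSorted : ∀ {c} → Wf c → StrictlyAbsSorted c
wf⇒strictlyAbsSorted (noComp , noDup , sorted) =
  abs≤-sorted⇒strictlyAbsSorted noComp noDup (sortedAbs⇒AllPairs sorted)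

head-abs-minimal : ∀ {x xs w} → StrictlyAbsSorted (x ∷ xs) → w ∈ x ∷ xs → ∣ x ∣ ≤ ∣ w ∣
head-abs-minimal _        (here refl) = ≤-refl
head-abs-minimal (x< ∷ _) (there w∈)  = <⇒≤ (All.lookup x< w∈)

abs≤head⇒≡head : ∀ {x xs w} → StrictlyAbsSorted (x ∷ xs) → w ∈ x ∷ xs → ∣ w ∣ ≤ ∣ x ∣ → w ≡ x
abs≤head⇒≡head _        (here refl) _   = refl
abs≤head⇒≡head (x< ∷ _) (there w∈)  w≤x = contradiction w≤x (<⇒≱ (All.lookup x< w∈))

∈-tail-of-abs> : ∀ {x xs w} → w ∈ x ∷ xs → ∣ x ∣ < ∣ w ∣ → w ∈ xs
∈-tail-of-abs> w∈ x<w = Any.tail (λ { refl → <-irrefl refl x<w }) w∈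

above⇒avoids : ∀ {a n xs} → a ≡ n → All (λ z → a < ∣ z ∣) xs → AbsAvoids n xs
above⇒avoids refl = All.map (λ a<z → ≢-sym (<⇒≢ a<z))

-- Case splits on the guards of union/auxunion go through this eliminator rather than
-- `with`, which would hide the lexicographic decrease of the recursion from the
-- termination checker.
if-⌊⌋-elim : ∀ {p q a} {P : Set p} {A : Set a} (Q : A → Set q) (d : Dec P) {u v : A} →
  (P → Q u) → (¬ P → Q v) → Q (if ⌊ d ⌋ then u else v)
if-⌊⌋-elim Q (yes p) onYes _    = onYes p
if-⌊⌋-elim Q (no ¬p) _    onNo = onNo ¬p

equal-abs-heads-clash : ∀ {x xs y ys l} →
  StrictlyAbsSorted (x ∷ xs) → StrictlyAbsSorted (y ∷ ys) → l ∈ x ∷ xs → - l ∈ y ∷ ys →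
  ∣ x ∣ ≡ ∣ y ∣ → ∣ x ∣ ≡ ∣ l ∣ → x + y ≡ 0ℤ
equal-abs-heads-clash {l = l} sx sy l∈ -l∈ x≡y x≡l
  with abs≤head⇒≡head sx l∈ (≤-reflexive (sym x≡l))
     | abs≤head⇒≡head sy -l∈ (≤-reflexive (trans (∣-i∣≡∣i∣ l) (trans (sym x≡l) x≡y)))
... | refl | refl = +-inverseʳ l

reverse⁺ : ∀ {a p} {A : Set a} {P : A → Set p} {xs : List A} → All P xs → All P (reverse xs)
reverse⁺ {xs = xs} = All-resp-↭ (↭-sym (↭-reverse xs))

auxunion-All : ∀ {p} {P : ℤ → Set p} xs ys acc → All P xs → All P ys → All P acc →
  All P (auxunion xs ys acc)
auxunion-All []       ys       acc _   pys pacc = ++⁺ (reverse⁺ pacc) pys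
auxunion-All (x ∷ xs) []       acc pxs _   pacc = ++⁺ (reverse⁺ pacc) pxs
auxunion-All {P = P} (x ∷ xs) (y ∷ ys) acc pxs@(px ∷ pxs′) pys@(py ∷ pys′) pacc =
  if-⌊⌋-elim (All P) (∣ x ∣ <? ∣ y ∣)
    (λ _ → auxunion-All xs (y ∷ ys) (x ∷ acc) pxs′ pys (px ∷ pacc)) λ _ →
  if-⌊⌋-elim (All P) (∣ y ∣ <? ∣ x ∣)
    (λ _ → auxunion-All (x ∷ xs) ys (y ∷ acc) pxs pys′ (py ∷ pacc)) λ _ →
  if-⌊⌋-elim (All P) (x ≟ y)
    (λ _ → auxunion-All xs ys (x ∷ acc) pxs′ pys′ (px ∷ pacc)) λ _ →
  auxunion-All xs ys (x ∷ y ∷ acc) pxs′ pys′ (px ∷ py ∷ pacc)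

ClashesOnlyAt : ℤ → Clause → Clause → Set
ClashesOnlyAt l xs ys = ∀ {m n} → m ∈ xs → n ∈ ys → m + n ≡ 0ℤ → m ≡ l

union-avoids-clash : ∀ {l} xs ys acc → StrictlyAbsSorted xs → StrictlyAbsSorted ys →
  l ∈ xs → - l ∈ ys → ClashesOnlyAt l xs ys →
  AbsAvoids ∣ l ∣ acc → AbsAvoids ∣ l ∣ (union xs ys acc)
union-avoids-clash []       _        _   _ _ () _ _ _
union-avoids-clash (_ ∷ _)  []       _   _ _ _ () _ _
union-avoids-clash {l} (x ∷ xs) (y ∷ ys) acc sx@(x< ∷ sxs) sy@(y< ∷ sys) l∈ -l∈ only avoid =
  if-⌊⌋-elim (AbsAvoids ∣ l ∣) (x + y ≟ 0ℤ) clash λ x+y≢0 →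
  if-⌊⌋-elim (AbsAvoids ∣ l ∣) (∣ x ∣ <? ∣ y ∣)
    (λ x<y → let x<l = <-≤-trans x<y y≤l in
      union-avoids-clash xs (y ∷ ys) (x ∷ acc) sxs sy (l∈xs x<l) -l∈
        (λ m∈ → only (there m∈)) (<⇒≢ x<l ∷ avoid)) λ x≮y →
  if-⌊⌋-elim (AbsAvoids ∣ l ∣) (∣ y ∣ <? ∣ x ∣)
    (λ y<x → let y<l = <-≤-trans y<x x≤l in
      union-avoids-clash (x ∷ xs) ys (y ∷ acc) sx sys l∈ (-l∈ys y<l)
        (λ m∈ n∈ → only m∈ (there n∈)) (<⇒≢ y<l ∷ avoid)) λ y≮x →
  let x≡y = ≤-antisym (≮⇒≥ y≮x) (≮⇒≥ x≮y)
      x<l = ≤∧≢⇒< x≤l (λ x≡l → x+y≢0 (equal-abs-heads-clash sx sy l∈ -l∈ x≡y x≡l))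
  in union-avoids-clash xs ys (x ∷ acc) sxs sys (l∈xs x<l) (-l∈ys (subst (_< ∣ l ∣) x≡y x<l))
       (λ m∈ n∈ → only (there m∈) (there n∈)) (<⇒≢ x<l ∷ avoid)
  where
  x≤l : ∣ x ∣ ≤ ∣ l ∣
  x≤l = head-abs-minimal sx l∈
  y≤l : ∣ y ∣ ≤ ∣ l ∣
  y≤l = ≤-trans (head-abs-minimal sy -l∈) (≤-reflexive (∣-i∣≡∣i∣ l))
  l∈xs : ∣ x ∣ < ∣ l ∣ → l ∈ xs
  l∈xs = ∈-tail-of-abs> l∈
  -l∈ys : ∣ y ∣ < ∣ l ∣ → - l ∈ ys
  -l∈ys y<l = ∈-tail-of-abs> -l∈ (subst (∣ y ∣ <_) (sym (∣-i∣≡∣i∣ l)) y<l)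
  clash : x + y ≡ 0ℤ → AbsAvoids ∣ l ∣ (auxunion xs ys acc)
  clash x+y≡0 = auxunion-All xs ys acc (above⇒avoids x≡l x<) (above⇒avoids y≡l y<) avoid
    where
    x≡l : ∣ x ∣ ≡ ∣ l ∣
    x≡l = cong ∣_∣ (only (here refl) (here refl) x+y≡0)
    y≡l : ∣ y ∣ ≡ ∣ l ∣
    y≡l = trans (cong ∣_∣ (inverseʳ-unique x y x+y≡0)) (trans (∣-i∣≡∣i∣ x) x≡l)

theorem2 : ∀ (c1 c2 : Clause) → Wf c1 → Wf c2 → UniqueCompPair c1 c2 →
    ∀ (l1 l2 : ℤ) → l1 ∈ c1 → l2 ∈ c2 → l1 + l2 ≡ 0ℤ →
    (l1 ∉ (c1 ⋈ c2)) × (l2 ∉ (c1 ⋈ c2))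
theorem2 c1 c2 wf1 wf2 (_ , _ , _ , unique) l1 l2 l1∈ l2∈ l1+l2≡0
  with inverseʳ-unique l1 l2 l1+l2≡0
... | refl = (λ l1∈⋈ → All.lookup avoid l1∈⋈ refl) , (λ l2∈⋈ → All.lookup avoid l2∈⋈ (∣-i∣≡∣i∣ l1))
  where
  only : ClashesOnlyAt l1 c1 c2
  only m∈ n∈ m+n≡0 =
    trans (proj₁ (unique _ _ m∈ n∈ m+n≡0)) (sym (proj₁ (unique l1 l2 l1∈ l2∈ l1+l2≡0)))
  avoid : AbsAvoids ∣ l1 ∣ (c1 ⋈ c2)
  avoid = union-avoids-clash c1 c2 [] (wf⇒strictlyAbsSorted wf1) (wf⇒strictlyAbsSorted wf2)
    l1∈ l2∈ only []
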